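{- Every restricted assignment instance with $m$ machines is also an instance of scheduling with resource restrictions with $m$ resources (i.e., there exist $m$ resources with capacities and demands inducing exactly the given eligibility sets). Moreover, for each $m\in\mathbb{N}$ there is an instance of scheduling with resource restrictions with $m$ resources, having $m$ machines and $m$ jobs, which is not an instance of scheduling with resource restrictions with $R$ resources for any $R<m$.
   Context: A restricted assignment instance consists of machines $\mathcal{M}$ and jobs $\mathcal{J}$, each job $j$ with processing time $p_j$ and a set $\mathcal{M}(j)\subseteq\mathcal{M}$ of eligible machines. It is an instance of scheduling with resource restrictions with $R$ resources if there exist a set $\mathcal{R}$ of $R$ resources, capacities $c_r(i)$ for each machine $i$ and demands $d_r(j)$ for each job $j$ and $r\in\mathcal{R}$ (real numbers), such that for every job $j$ and machine $i$: $i\in\mathcal{M}(j)$ iff $d_r(j)\le c_r(i)$ for all $r\in\mathcal{R}$.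
   Formalization: The processing times $p_j$ are rational, and the capacities $c_r(i)$ and demands $d_r(j)$ are taken in ℚ instead of the real numbers. -}

module Defs where

open import Data.Nat using (ℕ)
open import Data.Fin using (Fin)
open import Data.Fin.Subset using (Subset; _∈_)
open import Data.Rational using (ℚ; _≤_)
open import Data.Product using (Σ; Σ-syntax)
open import Function.Bundles using (_⇔_)

record RAInstance (m n : ℕ) : Set where
  field
    p    : Fin n → ℚ
    elig : Fin n → Subset m
open RAInstance public

IsResourceInstance : {m n : ℕ} → (R : ℕ) → RAInstance m n → Set
IsResourceInstance {m} {n} R I =
  Σ[ c ∈ (Fin R → Fin m → ℚ) ] Σ[ d ∈ (Fin R → Fin n → ℚ) ]
    (∀ (j : Fin n) (i : Fin m) → (i ∈ elig I j) ⇔ (∀ (r : Fin R) → d r j ≤ c r i))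

-- Upper bound: take one resource per machine r, of capacity 0 on r and 1 elsewhere, and
-- let job j demand 0 of r if r ∈ M(j) and 1 otherwise; then j fits on i iff i ∈ M(j).
-- Lower bound: in the instance with M(j) = all machines but j, every job j has a resource
-- r with c_r(j) < d_r(j).  With fewer resources than jobs two jobs j ≠ j' share such an r,
-- and since j fits on j' and j' on j we get d_r(j) ≤ c_r(j') < d_r(j') ≤ c_r(j) < d_r(j).
module Submission where

open import Defs
open import Data.Nat using (ℕ; _<_)
open import Data.Product using (_×_; Σ-syntax; _,_; proj₁; proj₂)
open import Relation.Nullary using (¬_; Dec; yes; no; contradiction)
open import Data.Fin using (Fin; _≟_)
open import Data.Fin.Properties using (¬∀⟶∃¬; pigeonhole; <⇒≢)
open import Data.Fin.Subset using (_∈_; _∉_; ⁅_⁆; ∁)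
open import Data.Fin.Subset.Properties using (_∈?_; x∈p⇒x∉∁p; x∉p⇒x∈∁p; x∈⁅x⁆; x≢y⇒x∉⁅y⁆)
open import Data.Rational using (ℚ; 0ℚ; 1ℚ; _≤_) renaming (_<_ to _<ℚ_)
open import Data.Rational.Properties
  using (≤-refl; ≰⇒>; _≤?_; ≤-<-trans; <-≤-trans; <-trans; <-irrefl; positive⁻¹; nonNegative⁻¹)
open import Function using (_∘_; id)
open import Function.Bundles using (_⇔_; mk⇔; Equivalence)
open import Relation.Binary.PropositionalEquality using (_≢_; ≢-sym; refl)

open Equivalence using (to; from)

bit : {P : Set} → Dec P → ℚ
bit (yes _) = 0ℚ
bit (no _)  = 1ℚ

bit-≤⇔ : {P Q : Set} (p : Dec P) (q : Dec Q) → bit p ≤ bit q ⇔ (Q → P)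
bit-≤⇔ (yes p) (yes _) = mk⇔ (λ _ _ → p) (λ _ → ≤-refl)
bit-≤⇔ (yes p) (no _)  = mk⇔ (λ _ _ → p) (λ _ → nonNegative⁻¹ 1ℚ)
bit-≤⇔ (no ¬p) (yes q) =
  mk⇔ (λ 1≤0 _ → contradiction (<-≤-trans (positive⁻¹ 1ℚ) 1≤0) (<-irrefl refl))
      (λ q⇒p → contradiction (q⇒p q) ¬p)
bit-≤⇔ (no _)  (no ¬q) = mk⇔ (λ _ q → contradiction q ¬q) (λ _ → ≤-refl)

restrictedAssignment⇒resourceInstance : {m n : ℕ} (I : RAInstance m n) → IsResourceInstance m I
restrictedAssignment⇒resourceInstance {m} {n} I = c , d , eligible⇔fits
  where
  c : Fin m → Fin m → ℚ
  c r i = bit (r ≟ i)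
  d : Fin m → Fin n → ℚ
  d r j = bit (r ∈? elig I j)

  eligible⇔fits : ∀ j i → (i ∈ elig I j) ⇔ (∀ r → d r j ≤ c r i)
  eligible⇔fits j i = mk⇔
    (λ i∈M r → from (bit-≤⇔ (r ∈? elig I j) (r ≟ i)) λ { refl → i∈M })
    (λ fits → to (bit-≤⇔ (i ∈? elig I j) (i ≟ i)) (fits i) refl)

module ResourceRepresentation {m n R : ℕ} {I : RAInstance m n}
  (c : Fin R → Fin m → ℚ) (d : Fin R → Fin n → ℚ)
  (eligible⇔fits : ∀ j i → (i ∈ elig I j) ⇔ (∀ r → d r j ≤ c r i)) where

  blockingResource : ∀ {j i} → i ∉ elig I j → Σ[ r ∈ Fin R ] c r i <ℚ d r j
  blockingResource {j} {i} i∉M with ¬∀⟶∃¬ R (λ r → d r j ≤ c r i) (λ r → d r j ≤? c r i)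
                                          (λ fits → i∉M (from (eligible⇔fits j i) fits))
  ... | r , ¬fits = r , ≰⇒> ¬fits

  crossed⇒distinctBlockers : ∀ {r r′ j j′ i i′} → c r i <ℚ d r j → c r′ i′ <ℚ d r′ j′ →
                             i′ ∈ elig I j → i ∈ elig I j′ → r ≢ r′
  crossed⇒distinctBlockers {r} {j = j} {j′} {i} {i′} blocks blocks′ i′∈M i∈M′ refl =
    <-irrefl refl (≤-<-trans (to (eligible⇔fits j i′) i′∈M r)
                    (<-trans blocks′ (≤-<-trans (to (eligible⇔fits j′ i) i∈M′ r) blocks)))

  crossingFamily⇒¬R<k : ∀ {k} (job : Fin k → Fin n) (machine : Fin k → Fin m) →
                             (∀ a → machine a ∉ elig I (job a)) →
                             (∀ {a b} → a ≢ b → machine b ∈ elig I (job a)) → ¬ R < k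
  crossingFamily⇒¬R<k job machine outside inside R<k
    with a , b , a<b , same ← pigeonhole R<k (proj₁ ∘ blockingResource ∘ outside) =
    crossed⇒distinctBlockers (proj₂ (blockingResource (outside a)))
                             (proj₂ (blockingResource (outside b)))
      (inside (<⇒≢ a<b)) (inside (≢-sym (<⇒≢ a<b))) same

allButOne : (m : ℕ) → RAInstance m m
allButOne m = record { p = λ _ → 0ℚ ; elig = λ j → ∁ ⁅ j ⁆ }

allButOne-needsAllResources : ∀ {m R} → R < m → ¬ IsResourceInstance R (allButOne m)
allButOne-needsAllResources {m} R<m (c , d , eligible⇔fits) =
  crossingFamily⇒¬R<k id id (λ j → x∈p⇒x∉∁p (x∈⁅x⁆ j))
    (λ a≢b → x∉p⇒x∈∁p (x≢y⇒x∉⁅y⁆ (≢-sym a≢b))) R<m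
  where open ResourceRepresentation {I = allButOne m} c d eligible⇔fits

mainTheorem5 :
    ((m n : ℕ) (I : RAInstance m n) → IsResourceInstance m I)
    × ((m : ℕ) → Σ[ I ∈ RAInstance m m ]
         (IsResourceInstance m I × ((R : ℕ) → R < m → ¬ IsResourceInstance R I)))
mainTheorem5 =
  (λ _ _ → restrictedAssignment⇒resourceInstance) ,
  λ m → allButOne m , restrictedAssignment⇒resourceInstance (allButOne m) ,
        λ _ → allButOne-needsAllResources
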